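{- Let $f$ be a Boolean network of dimension $n$. For all $x,y\in\{0,1\}^n$: $\mathrm{enc}(y)$ is reachable from $\mathrm{enc}(x)$ in the Read Petri net $\mathrm{enc}(f)$ under the interval semantics (i.e., the marking $\{p^c,p^r\mid p\in\mathrm{enc}(y)\}$ of $\mathrm{split}(\mathrm{enc}(f))$ is reachable by an a-run from the marking $\{p^c,p^r\mid p\in\mathrm{enc}(x)\}$) if and only if $\alpha(y)$ is reachable from $\alpha(x)$ in zero or more steps of the asynchronous updating of the Boolean network $f^{IS}$.
   Context: A Boolean network (BN) of dimension $n$ is a tuple $f=\langle f_1,\dots,f_n\rangle$ of functions $f_i:\{0,1\}^n\to\{0,1\}$. Asynchronous updating: $x\to y$ iff there is $i$ with $\{j\mid x_j\ne y_j\}=\{i\}$ and $y_i=f_i(x)$. A (safe) Read Petri net (RPN) is $N=(P,T,\mathrm{pre},\mathrm{cont},\mathrm{post},M_0)$ with finite sets of places $P$ and transitions $T$; each $t$ has nonempty preset ${}^\bullet t\subseteq P$, context $\underline t\subseteq P\setminus{}^\bullet t$ (disjoint from the postset), postset $t^\bullet\subseteq P$; $M_0\subseteq P$. A marking is $M\subseteq P$; $t$ is enabled in $M$ if ${}^\bullet t\cup\underline t\subseteq M$, and firing it gives $(M\setminus{}^\bullet t)\cup t^\bullet$ (atomic semantics); an a-run is a sequence of successive firings. Safety: whenever $t$ is enabled in $M$, $(M\setminus{}^\bullet t)\cap t^\bullet=\emptyset$. $\mathrm{split}(N)$ is the RPN with transitions $t^-,t^+$ for each $t\in T$, places $p^c,p^r$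 for each $p\in P$ plus a place $p_t$ per $t\in T$, with ${}^\bullet t^-=\{p^c\mid p\in{}^\bullet t\}$, $\underline{t^- }=\{p^r\mid p\in\underline t\}$, $t^{ -\bullet}=\{p_t\}$, ${}^\bullet t^+=\{p^r\mid p\in{}^\bullet t\}\cup\{p_t\}$, $\underline{t^+}=\emptyset$, $t^{+\bullet}=\{p^c,p^r\mid p\in t^\bullet\}$, initial marking $\{p^c,p^r\mid p\in M_0\}$. The interval semantics of $N$ consists of the a-runs of $\mathrm{split}(N)$. Encoding $\mathrm{enc}(f)$: places $\{1,\dots,2n\}$ (place $i$ means node $i$ has value 0, place $i+n$ means value 1). For each $i$ and each conjunctive clause $C$ (a set of literals) of the disjunctive normal form of $\neg x_i\wedge f_i(x)$ there is a transition with preset $\{i\}$, postset $\{i+n\}$ and context $\{j\mid \neg x_j\in C,j\ne i\}\cup\{j+n\mid x_j\in C, j\neq i\}$; for each clause $C$ of the DNF of $x_i\wedge\neg f_i(x)$ a transition with preset $\{i+n\}$, postset $\{i\}$ and the same form of context. For $x\in\{0,1\}^n$, $\mathrm{enc}(x)=\{i+nx_i\mid i\in\{1,\dots,n\}\}$. $f^{IS}$ is the BN of dimension $2n$ with, for $z\in\{0,1\}^{2n}$ and $i\in\{1,\dots,n\}$: $f^{IS}_{2i-1}(z)=(f_i(\gamma(z))\wedge(\neg z_{2i}\vee z_{2i-1}))\vee(\neg z_{2i}\wedge z_{2i-1})$ and $f^{IS}_{2i}(z)=z_{2i-1}$, where $\gamma(z)_i=z_{2i}$. For $x\in\{0,1\}^n$,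 $\alpha(x)\in\{0,1\}^{2n}$ is given by $\alpha(x)_{2i-1}=\alpha(x)_{2i}=x_i$. -}

module Defs where

open import Data.Nat using (ℕ; _*_)
open import Data.Fin using (Fin; zero; suc; combine; remQuot)
open import Data.Bool using (Bool; true; false; not; _∧_; _∨_)
open import Data.Product using (Σ; Σ-syntax; _×_; _,_; proj₁; proj₂)
open import Data.Sum using (_⊎_)
open import Data.Empty using (⊥)
open import Data.List using (List; length; lookup)
open import Data.List.Relation.Unary.All using (All)
open import Data.List.Relation.Unary.Any using (Any)
open import Data.List.Membership.Propositional using (_∈_)
open import Relation.Nullary using (¬_)
open import Relation.Binary.PropositionalEquality using (_≡_; _≢_)
open import Relation.Binary.Construct.Closure.ReflexiveTransitive using (Star)
open import Function.Bundles using (_⇔_)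

-- Reachability up to pointwise equality of the endpoint (states and
-- markings are functions; this avoids needing function extensionality).

Reach : {A B : Set} → ((A → B) → (A → B) → Set) → (A → B) → (A → B) → Set
Reach R a b = Σ[ c ∈ _ ] (Star R a c × (∀ p → c p ≡ b p))

State : ℕ → Set
State n = Fin n → Bool

BN : ℕ → Set
BN n = State n → Fin n → Bool

AsyncStep : {n : ℕ} → BN n → State n → State n → Set
AsyncStep {n} f x y =
  Σ[ i ∈ Fin n ] ((x i ≢ y i) × (y i ≡ f x i) × (∀ j → j ≢ i → x j ≡ y j))

record RPN (P T : Set) : Set₁ where
  field
    pre  : T → P → Set
    cont : T → P → Set
    post : T → P → Set

Marking : Set → Set
Marking P = P → Bool

module _ {P T : Set} (N : RPN P T) where
  open RPN N

  Enabled : T → Marking P → Set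
  Enabled t M = ∀ p → pre t p ⊎ cont t p → M p ≡ true

  Fires : T → Marking P → Marking P → Set
  Fires t M M' = ∀ p → (M' p ≡ true) ⇔ (post t p ⊎ (M p ≡ true × ¬ pre t p))

  NetStep : Marking P → Marking P → Set
  NetStep M M' = Σ[ t ∈ T ] (Enabled t M × Fires t M M')

data SplitPlace (P T : Set) : Set where
  cpl : P → SplitPlace P T
  rpl : P → SplitPlace P T
  tpl : T → SplitPlace P T

data Phase : Set where
  minus plus : Phase

module _ {P T : Set} (N : RPN P T) where
  open RPN N

  splitPre : T × Phase → SplitPlace P T → Set
  splitPre (t , minus) (cpl p) = pre t p
  splitPre (t , minus) (rpl p) = ⊥
  splitPre (t , minus) (tpl u) = ⊥
  splitPre (t , plus)  (cpl p) = ⊥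
  splitPre (t , plus)  (rpl p) = pre t p
  splitPre (t , plus)  (tpl u) = u ≡ t

  splitCont : T × Phase → SplitPlace P T → Set
  splitCont (t , minus) (cpl p) = ⊥
  splitCont (t , minus) (rpl p) = cont t p
  splitCont (t , minus) (tpl u) = ⊥
  splitCont (t , plus)  _       = ⊥

  splitPost : T × Phase → SplitPlace P T → Set
  splitPost (t , minus) (cpl p) = ⊥
  splitPost (t , minus) (rpl p) = ⊥
  splitPost (t , minus) (tpl u) = u ≡ t
  splitPost (t , plus)  (cpl p) = post t p
  splitPost (t , plus)  (rpl p) = post t p
  splitPost (t , plus)  (tpl u) = ⊥

  split : RPN (SplitPlace P T) (T × Phase)
  split = record { pre = splitPre ; cont = splitCont ; post = splitPost }

liftMarking : {P T : Set} → Marking P → Marking (SplitPlace P T)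
liftMarking M (cpl p) = M p
liftMarking M (rpl p) = M p
liftMarking M (tpl t) = false

Literal : ℕ → Set
Literal n = Fin n × Bool

Clause : ℕ → Set
Clause n = List (Literal n)

Sat : {n : ℕ} → State n → Clause n → Set
Sat x C = All (λ l → x (proj₁ l) ≡ proj₂ l) C

Consistent : {n : ℕ} → Clause n → Set
Consistent {n} C = ∀ (j : Fin n) → (j , true) ∈ C → (j , false) ∈ C → ⊥

DNFs : ℕ → Set
DNFs n = Fin n → Bool → List (Clause n)

IsDNFs : {n : ℕ} → BN n → DNFs n → Set
IsDNFs {n} f D = ∀ (i : Fin n) (b : Bool) →
  (∀ C → C ∈ D i b → Consistent C) ×
  (∀ (x : State n) → Any (Sat x) (D i b) ⇔ (x i ≡ b × f x i ≡ not b))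

-- enc(f).  Place (i , false) is place i (x_i = 0),
-- place (i , true) is place i+n (x_i = 1).

EncPlace : ℕ → Set
EncPlace n = Fin n × Bool

EncTrans : {n : ℕ} → DNFs n → Set
EncTrans {n} D = Σ[ i ∈ Fin n ] Σ[ b ∈ Bool ] Fin (length (D i b))

enc : {n : ℕ} → (D : DNFs n) → RPN (EncPlace n) (EncTrans D)
enc D = record
  { pre  = λ { (i , b , k) (j , v) → j ≡ i × v ≡ b }
  ; cont = λ { (i , b , k) (j , v) → (j , v) ∈ lookup (D i b) k × j ≢ i }
  ; post = λ { (i , b , k) (j , v) → j ≡ i × v ≡ not b }
  }

encState : {n : ℕ} → State n → Marking (EncPlace n)
encState x (i , false) = not (x i)
encState x (i , true)  = x i

-- f^IS, dimension n * 2.  Component  combine i zero  is z_{2i-1},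
-- component  combine i (suc zero)  is z_{2i}  (1-based indices of the paper).

γ : {n : ℕ} → State (n * 2) → State n
γ z i = z (combine i (suc zero))

fIS : {n : ℕ} → BN n → BN (n * 2)
fIS {n} f z k with remQuot {n} 2 k
... | (i , zero) =
  (f (γ z) i ∧ (not (z (combine i (suc zero))) ∨ z (combine i zero)))
  ∨ (not (z (combine i (suc zero))) ∧ z (combine i zero))
... | (i , suc _) = z (combine i zero)

α : {n : ℕ} → State n → State (n * 2)
α {n} x k = x (proj₁ (remQuot {n} 2 k))

module Submission where

-- Write a state z of f^IS as a pair of vectors: the visible value  γ z i = z_{2i}
-- (the value other nodes read) and the pending value  z_{2i-1}.  We relate a
-- marking M of split(enc f) to such a state z (relation Sim):
--   * the r-places always encode the visible values;
--   * each node i is either idle (pending = visible, its c-places encode the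
--     visible value, no t-place of node i is marked) or busy (pending = ¬visible,
--     its c-places are empty and exactly one t-place p_t of node i is marked).
-- Firing t^- turns an idle node busy, which is the f^IS update of z_{2i-1};
-- firing t^+ completes the transition, which is the f^IS update of z_{2i}.
-- Conversely each f^IS step is of one of these two kinds (lemma backward), the
-- enabling context of t^- being obtained from the DNF of f (lemma clause-flips).
-- Sim is therefore a bisimulation; lifting single steps to runs (simulate) and
-- checking the initial and final markings/states gives the theorem.

open import Defs
open import Data.Nat using (ℕ; _*_)
open import Data.Bool using (Bool; true; false; not; _∧_; _∨_)
import Data.Bool as Bool
open import Data.Bool.Properties using (not-¬; ¬-not; ⇔→≡)
open import Data.Empty using (⊥-elim)
open import Data.Fin using (Fin; zero; suc; combine; remQuot)
import Data.Fin as Fin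
open import Data.Fin.Properties
  using (remQuot-combine; combine-remQuot; combine-injectiveˡ; combine-injectiveʳ)
open import Data.Product using (Σ-syntax; _×_; _,_; proj₁; proj₂; uncurry)
open import Data.Product.Properties using (≡-dec)
open import Data.Sum using (inj₁; inj₂; [_,_])
open import Data.List using (length; lookup)
import Data.List.Relation.Unary.All as All
open import Data.List.Relation.Unary.Any as Any using (Any)
open import Data.List.Relation.Unary.Any.Properties using (lookup-index)
open import Data.List.Membership.Propositional using (_∈_; lose)
open import Data.List.Membership.Propositional.Properties using (∈-lookup)
open import Data.Vec.Functional using (updateAt)
open import Data.Vec.Functional.Properties using (updateAt-updates; updateAt-minimal)
open import Function using (const; flip; _∘_)
open import Function.Bundles using (_⇔_; mk⇔; Equivalence)
open import Relation.Nullary using (¬_; Dec; yes; no; does; contradiction)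
open import Relation.Nullary.Decidable using (_×-dec_)
open import Relation.Binary.Definitions using (DecidableEquality)
open import Relation.Binary.PropositionalEquality
  using (_≡_; _≢_; refl; sym; trans; cong; subst; module ≡-Reasoning)
open import Relation.Binary.Construct.Closure.ReflexiveTransitive using (Star; ε; _◅_)

marked : Bool → Bool → Bool
marked b false = not b
marked b true  = b

encState-marked : ∀ {n} (x : State n) i w → encState x (i , w) ≡ marked (x i) w
encState-marked x i false = refl
encState-marked x i true  = refl

marked-≡ : ∀ {b w} → b ≡ w → marked b w ≡ true
marked-≡ {false} refl = refl
marked-≡ {true}  refl = refl

marked-self : ∀ b → marked b b ≡ true
marked-self b = marked-≡ {b} refl

marked-≢ : ∀ {b w} → b ≢ w → marked b w ≡ false
marked-≢ {false} {false} b≢w = contradiction refl b≢w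
marked-≢ {false} {true}  _   = refl
marked-≢ {true}  {false} _   = refl
marked-≢ {true}  {true}  b≢w = contradiction refl b≢w

marked⇒≡ : ∀ {b w} → marked b w ≡ true → b ≡ w
marked⇒≡ {false} {false} _ = refl
marked⇒≡ {false} {true}  ()
marked⇒≡ {true}  {false} ()
marked⇒≡ {true}  {true}  _ = refl

module _ {P T : Set} (N : RPN P T) where
  open RPN N

  module _ (t : T) {M M' : Marking P} (fires : Fires N t M M') where

    fired-unchanged : ∀ q → ¬ pre t q → ¬ post t q → M' q ≡ M q
    fired-unchanged q ¬pre ¬post = ⇔→≡ {z = true} (mk⇔
      (λ M'q → [ (λ post → contradiction post ¬post) , proj₁ ] (Equivalence.to (fires q) M'q))
      (λ Mq → Equivalence.from (fires q) (inj₂ (Mq , ¬pre))))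

    fired-produced : ∀ q → post t q → M' q ≡ true
    fired-produced q post = Equivalence.from (fires q) (inj₁ post)

    fired-consumed : ∀ q → pre t q → ¬ post t q → M' q ≡ false
    fired-consumed q pre ¬post = ¬-not λ M'q →
      [ ¬post , (λ (_ , ¬pre) → ¬pre pre) ] (Equivalence.to (fires q) M'q)

  module Successor (pre? : ∀ t q → Dec (pre t q)) (post? : ∀ t q → Dec (post t q)) where

    fire : T → Marking P → Marking P
    fire t M q = does (post? t q) ∨ (M q ∧ not (does (pre? t q)))

    fire-fires : ∀ t M → Fires N t M (fire t M)
    fire-fires t M q with post? t q | pre? t q | M q
    ... | yes post | _        | _     = mk⇔ (λ _ → inj₁ post) (λ _ → refl)
    ... | no ¬post | yes pre  | false = mk⇔ (λ ()) (⊥-elim ∘ [ ¬post , (λ ()) ∘ proj₁ ])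
    ... | no ¬post | yes pre  | true  = mk⇔ (λ ()) (⊥-elim ∘ [ ¬post , (λ (_ , ¬pre) → ¬pre pre) ])
    ... | no ¬post | no ¬pre  | false = mk⇔ (λ ()) (⊥-elim ∘ [ ¬post , (λ ()) ∘ proj₁ ])
    ... | no ¬post | no ¬pre  | true  = mk⇔ (λ _ → inj₂ (refl , ¬pre)) (λ _ → refl)

simulate : {A B : Set} {R : A → A → Set} {S : B → B → Set} (_~_ : A → B → Set) →
  (∀ {a a' b} → a ~ b → R a a' → Σ[ b' ∈ B ] (S b b' × a' ~ b')) →
  ∀ {a a' b} → a ~ b → Star R a a' → Σ[ b' ∈ B ] (Star S b b' × a' ~ b')
simulate _~_ step a~b ε = _ , ε , a~b
simulate _~_ step a~b (r ◅ rs) with step a~b r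
... | b₁ , s , a₁~b₁ with simulate _~_ step a₁~b₁ rs
...   | b₂ , ss , a₂~b₂ = b₂ , s ◅ ss , a₂~b₂

Update : ∀ {m} → State m → Fin m → Bool → State m → Set
Update z k w z' = z' k ≡ w × (∀ j → j ≢ k → z j ≡ z' j)

update-updateAt : ∀ {m} (z : State m) k w → Update z k w (updateAt z k (const w))
update-updateAt z k w = updateAt-updates k z , λ j j≢k → sym (updateAt-minimal j k z j≢k)

step⇒update : ∀ {m} (g : BN m) {z z'} → AsyncStep g z z' →
  Σ[ k ∈ Fin m ] (z k ≢ g z k × Update z k (g z k) z')
step⇒update g (k , changed , new , off) = k , (λ e → changed (trans e (sym new))) , new , off

update⇒step : ∀ {m} (g : BN m) {z z' k w} → Update z k w z' → w ≡ g z k → z k ≢ w →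
  AsyncStep g z z'
update⇒step g {k = k} (new , off) w≡g changed =
  k , (λ e → changed (trans e new)) , trans new w≡g , off

module _ {n : ℕ} where

  pend vis : Fin n → Fin (n * 2)
  pend i = combine i zero
  vis  i = combine i (suc zero)

  pending : State (n * 2) → State n
  pending z i = z (pend i)

  data Coordinate : Fin (n * 2) → Set where
    pendC : ∀ i → Coordinate (pend i)
    visC  : ∀ i → Coordinate (vis i)

  coordinate : ∀ k → Coordinate k
  coordinate k = subst Coordinate (combine-remQuot {n} 2 k) (of-pair (remQuot {n} 2 k))
    where
    of-pair : ∀ (ij : Fin n × Fin 2) → Coordinate (uncurry combine ij)
    of-pair (i , zero)     = pendC i
    of-pair (i , suc zero) = visC i

  pend≢vis : ∀ i i' → pend i ≢ vis i'
  pend≢vis i i' e with combine-injectiveʳ i zero i' (suc zero) e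
  ... | ()

  module _ {z z' : State (n * 2)} {i : Fin n} {w : Bool} where

    pend-update-other : Update z (pend i) w z' → ∀ {i'} → i' ≢ i → pending z' i' ≡ pending z i'
    pend-update-other (_ , off) i'≢i = sym (off _ (i'≢i ∘ combine-injectiveˡ _ zero i zero))

    pend-update-visible : Update z (pend i) w z' → ∀ i' → γ z' i' ≡ γ z i'
    pend-update-visible (_ , off) i' = sym (off (vis i') (pend≢vis i i' ∘ sym))

    vis-update-other : Update z (vis i) w z' → ∀ {i'} → i' ≢ i → γ z' i' ≡ γ z i'
    vis-update-other (_ , off) i'≢i = sym (off _ (i'≢i ∘ combine-injectiveˡ _ (suc zero) i (suc zero)))

    vis-update-pending : Update z (vis i) w z' → ∀ i' → pending z' i' ≡ pending z i'
    vis-update-pending (_ , off) i' = sym (off (pend i') (pend≢vis i' i))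

  -- the defining formula of f^IS at z_{2i-1}, with F = f_i(γ z), v = z_{2i}, p = z_{2i-1}
  pendingRule : Bool → Bool → Bool → Bool
  pendingRule F v p = (F ∧ (not v ∨ p)) ∨ (not v ∧ p)

  pendingRule-idle : ∀ F v → pendingRule F v v ≡ F
  pendingRule-idle false false = refl
  pendingRule-idle false true  = refl
  pendingRule-idle true  false = refl
  pendingRule-idle true  true  = refl

  pendingRule-busy : ∀ F v → pendingRule F v (not v) ≡ not v
  pendingRule-busy false false = refl
  pendingRule-busy false true  = refl
  pendingRule-busy true  false = refl
  pendingRule-busy true  true  = refl

  fIS-pend : (f : BN n) (z : State (n * 2)) (i : Fin n) → fIS f z (pend i) ≡ pendingRule (f (γ z) i) (γ z i) (pending z i)
  fIS-pend f z i rewrite remQuot-combine {n} {2} i zero = refl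

  fIS-vis : (f : BN n) (z : State (n * 2)) (i : Fin n) → fIS f z (vis i) ≡ pending z i
  fIS-vis f z i rewrite remQuot-combine {n} {2} i (suc zero) = refl

  fIS-idle : (f : BN n) (z : State (n * 2)) (i : Fin n) → pending z i ≡ γ z i → fIS f z (pend i) ≡ f (γ z) i
  fIS-idle f z i p≡v = begin
    fIS f z (pend i)                              ≡⟨ fIS-pend f z i ⟩
    pendingRule (f (γ z) i) (γ z i) (pending z i) ≡⟨ cong (pendingRule (f (γ z) i) (γ z i)) p≡v ⟩
    pendingRule (f (γ z) i) (γ z i) (γ z i)       ≡⟨ pendingRule-idle (f (γ z) i) (γ z i) ⟩
    f (γ z) i                                     ∎
    where open ≡-Reasoning

  fIS-busy : (f : BN n) (z : State (n * 2)) (i : Fin n) → pending z i ≡ not (γ z i) → fIS f z (pend i) ≡ pending z i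
  fIS-busy f z i p≡¬v = begin
    fIS f z (pend i)                              ≡⟨ fIS-pend f z i ⟩
    pendingRule (f (γ z) i) (γ z i) (pending z i) ≡⟨ cong (pendingRule (f (γ z) i) (γ z i)) p≡¬v ⟩
    pendingRule (f (γ z) i) (γ z i) (not (γ z i)) ≡⟨ pendingRule-busy (f (γ z) i) (γ z i) ⟩
    not (γ z i)                                   ≡⟨ sym p≡¬v ⟩
    pending z i                                   ∎
    where open ≡-Reasoning

  α-pend : (x : State n) (i : Fin n) → pending (α x) i ≡ x i
  α-pend x i = cong (x ∘ proj₁) (remQuot-combine {n} {2} i zero)

  α-vis : (x : State n) (i : Fin n) → γ (α x) i ≡ x i
  α-vis x i = cong (x ∘ proj₁) (remQuot-combine {n} {2} i (suc zero))

consistent-agree : ∀ {n} {C : Clause n} → Consistent C →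
  ∀ {j w w'} → (j , w) ∈ C → (j , w') ∈ C → w ≡ w'
consistent-agree cons {w = false} {false} _ _ = refl
consistent-agree cons {j} {false} {true}  m m' = ⊥-elim (cons j m' m)
consistent-agree cons {j} {true}  {false} m m' = ⊥-elim (cons j m m')
consistent-agree cons {w = true}  {true}  _ _ = refl

-- A clause C of the DNF of  x_i = b ∧ f_i(x) = ¬b  holds in any x with x_i = b
-- satisfying the literals of C on the other nodes (consistency forbids C from
-- asking x_i = ¬b); hence f_i(x) = ¬b.  This is what makes the context of t^-
-- a sufficient guard.
clause-flips : ∀ {n} {f : BN n} {D : DNFs n} → IsDNFs f D → ∀ {i b C} → C ∈ D i b →
  (x : State n) → x i ≡ b → (∀ {j w} → (j , w) ∈ C → j ≢ i → x j ≡ w) → f x i ≡ not b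
clause-flips {n} {f} isD {i} {b} {C} C∈D x xi≡b off =
  proj₂ (dnf x (satisfied x off (λ m → trans xi≡b (sym (literal-on-i m)))))
  where
  dnf : ∀ y → Sat y C → y i ≡ b × f y i ≡ not b
  dnf y sat = Equivalence.to (proj₂ (isD i b) y) (lose C∈D sat)

  satisfied : ∀ y → (∀ {j w} → (j , w) ∈ C → j ≢ i → y j ≡ w) →
    (∀ {w} → (i , w) ∈ C → y i ≡ w) → Sat y C
  satisfied y off' on = All.tabulate literal
    where
    literal : ∀ {l} → l ∈ C → y (proj₁ l) ≡ proj₂ l
    literal {j , w} m with j Fin.≟ i
    ... | yes refl = on m
    ... | no j≢i   = off' m j≢i

  -- were some literal (i , w) with w ≠ b in C, setting x_i := w would satisfy C,
  -- and the DNF would force x_i = b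
  literal-on-i : ∀ {w} → (i , w) ∈ C → w ≡ b
  literal-on-i {w} m with w Bool.≟ b
  ... | yes w≡b = w≡b
  ... | no w≢b  = contradiction (proj₁ (dnf x' (satisfied x' off' on')))
                                (w≢b ∘ trans (sym (updateAt-updates i x)))
    where
    x' : State n
    x' = updateAt x i (const w)
    off' : ∀ {j w'} → (j , w') ∈ C → j ≢ i → x' j ≡ w'
    off' m' j≢i = trans (updateAt-minimal _ i x j≢i) (off m' j≢i)
    on' : ∀ {w'} → (i , w') ∈ C → x' i ≡ w'
    on' m' = trans (updateAt-updates i x) (consistent-agree (proj₁ (isD i b) C C∈D) m m')

module Simulation {n : ℕ} (f : BN n) (D : DNFs n) (isD : IsDNFs f D) where

  Trans : Set
  Trans = EncTrans D

  Mark : Set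
  Mark = Marking (SplitPlace (EncPlace n) Trans)

  N : RPN (SplitPlace (EncPlace n) Trans) (Trans × Phase)
  N = split (enc D)

  _≟ₜ_ : DecidableEquality Trans
  _≟ₜ_ = ≡-dec Fin._≟_ (≡-dec Bool._≟_ Fin._≟_)

  pre? : ∀ t q → Dec (RPN.pre N t q)
  pre? ((i , b , k) , minus) (cpl (j , w)) = (j Fin.≟ i) ×-dec (w Bool.≟ b)
  pre? (_ , minus)           (rpl _)       = no λ ()
  pre? (_ , minus)           (tpl _)       = no λ ()
  pre? (_ , plus)            (cpl _)       = no λ ()
  pre? ((i , b , k) , plus)  (rpl (j , w)) = (j Fin.≟ i) ×-dec (w Bool.≟ b)
  pre? (t , plus)            (tpl u)       = u ≟ₜ t

  post? : ∀ t q → Dec (RPN.post N t q)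
  post? (_ , minus)           (cpl _)       = no λ ()
  post? (_ , minus)           (rpl _)       = no λ ()
  post? (t , minus)           (tpl u)       = u ≟ₜ t
  post? ((i , b , k) , plus)  (cpl (j , w)) = (j Fin.≟ i) ×-dec (w Bool.≟ not b)
  post? ((i , b , k) , plus)  (rpl (j , w)) = (j Fin.≟ i) ×-dec (w Bool.≟ not b)
  post? (_ , plus)            (tpl _)       = no λ ()

  open Successor N pre? post? using (fire; fire-fires)

  data Node (M : Mark) (i : Fin n) (p v : Bool) : Set where
    idle : p ≡ v → (∀ w → M (cpl (i , w)) ≡ marked v w) →
           (∀ t → proj₁ t ≡ i → M (tpl t) ≡ false) → Node M i p v
    -- t^- of (i , v , k) has fired and t^+ has not
    busy : (k : Fin (length (D i v))) → p ≡ not v → (∀ w → M (cpl (i , w)) ≡ false) →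
           M (tpl (i , v , k)) ≡ true →
           (∀ t → proj₁ t ≡ i → M (tpl t) ≡ true → t ≡ (i , v , k)) → Node M i p v

  record Sim (M : Mark) (z : State (n * 2)) : Set where
    field
      visible : ∀ i w → M (rpl (i , w)) ≡ marked (γ z i) w
      node    : ∀ i → Node M i (pending z i) (γ z i)
  open Sim

  node-transport : ∀ {M M' i p v} → Node M i p v →
    (∀ w → M' (cpl (i , w)) ≡ M (cpl (i , w))) →
    (∀ t → proj₁ t ≡ i → M' (tpl t) ≡ M (tpl t)) → Node M' i p v
  node-transport (idle p≡v c-places t-empty) c≡ t≡ =
    idle p≡v (λ w → trans (c≡ w) (c-places w)) (λ t t∈i → trans (t≡ t t∈i) (t-empty t t∈i))
  node-transport (busy k p≡¬v c-empty marked-t unique) c≡ t≡ =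
    busy k p≡¬v (λ w → trans (c≡ w) (c-empty w)) (trans (t≡ _ refl) marked-t)
         (λ t t∈i marked → unique t t∈i (trans (sym (t≡ t t∈i)) marked))

  node-cast : ∀ {M i p v p' v'} → Node M i p v → p' ≡ p → v' ≡ v → Node M i p' v'
  node-cast nd refl refl = nd

  minus-idle : ∀ {M z i c k} → Sim M z → Enabled N ((i , c , k) , minus) M →
    pending z i ≡ c × γ z i ≡ c
  minus-idle {M} {z} {i} {c} sim en with node sim i | en (cpl (i , c)) (inj₁ (refl , refl))
  ... | idle p≡v c-places _  | c-marked = trans p≡v v≡c , v≡c
    where
    v≡c : γ z i ≡ c
    v≡c = marked⇒≡ (trans (sym (c-places c)) c-marked)
  ... | busy _ _ c-empty _ _ | c-marked = contradiction (trans (sym c-marked) (c-empty c)) λ ()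

  minus-guard : ∀ {M z i c k} → Sim M z → Enabled N ((i , c , k) , minus) M → f (γ z) i ≡ not c
  minus-guard {M} {z} {i} {c} {k} sim en =
    clause-flips isD (∈-lookup k) (γ z) (proj₂ (minus-idle sim en)) context
    where
    context : ∀ {j w} → (j , w) ∈ lookup (D i c) k → j ≢ i → γ z j ≡ w
    context {j} {w} m j≢i = marked⇒≡ (trans (sym (visible sim j w)) (en (rpl (j , w)) (inj₂ (m , j≢i))))

  minus-effect : ∀ {M M' z z' i c k} → Sim M z → Enabled N ((i , c , k) , minus) M →
    Fires N ((i , c , k) , minus) M M' → Update z (pend i) (not c) z' → Sim M' z'
  minus-effect {M} {M'} {z} {z'} {i} {c} {k} sim en fires upd with node sim i
  ... | busy _ _ c-empty _ _ =
    contradiction (trans (sym (en (cpl (i , c)) (inj₁ (refl , refl)))) (c-empty c)) λ ()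
  ... | idle _ c-places t-empty = record { visible = visible' ; node = node' }
    where
    τ : Trans × Phase
    τ = ((i , c , k) , minus)
    v≡c : γ z i ≡ c
    v≡c = proj₂ (minus-idle sim en)

    visible' : ∀ i' w → M' (rpl (i' , w)) ≡ marked (γ z' i') w
    visible' i' w = trans (fired-unchanged N τ fires (rpl (i' , w)) (λ ()) (λ ()))
      (trans (visible sim i' w) (cong (λ b → marked b w) (sym (pend-update-visible upd i'))))

    c-empty' : ∀ w → M' (cpl (i , w)) ≡ false
    c-empty' w with w Bool.≟ c
    ... | yes refl = fired-consumed N τ fires (cpl (i , c)) (refl , refl) (λ ())
    ... | no w≢c   = trans (fired-unchanged N τ fires (cpl (i , w)) (w≢c ∘ proj₂) (λ ()))
                       (trans (c-places w) (marked-≢ (λ v≡w → w≢c (trans (sym v≡w) v≡c))))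

    unique : ∀ t → proj₁ t ≡ i → M' (tpl t) ≡ true → t ≡ (i , c , k)
    unique t t∈i t-marked with t ≟ₜ (i , c , k)
    ... | yes t≡ = t≡
    ... | no t≢  = contradiction
      (trans (sym t-marked) (trans (fired-unchanged N τ fires (tpl t) (λ ()) t≢) (t-empty t t∈i))) λ ()

    node' : ∀ i' → Node M' i' (pending z' i') (γ z' i')
    node' i' with i' Fin.≟ i
    ... | yes refl = node-cast
      (busy k refl c-empty' (fired-produced N τ fires (tpl (i , c , k)) refl) unique)
      (proj₁ upd) (trans (pend-update-visible upd i) v≡c)
    ... | no i'≢i = node-cast
      (node-transport (node sim i')
        (λ w → fired-unchanged N τ fires (cpl (i' , w)) (i'≢i ∘ proj₁) (λ ()))
        (λ t t∈i' → fired-unchanged N τ fires (tpl t) (λ ())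
                      (λ t≡ → i'≢i (trans (sym t∈i') (cong proj₁ t≡)))))
      (pend-update-other upd i'≢i) (pend-update-visible upd i')

  plus-busy : ∀ {M z i c k} → Sim M z → Enabled N ((i , c , k) , plus) M →
    γ z i ≡ c × pending z i ≡ not c
  plus-busy {M} {z} {i} {c} {k} sim en with node sim i
  ... | idle _ _ t-empty =
    contradiction (trans (sym (en (tpl (i , c , k)) (inj₁ refl))) (t-empty _ refl)) λ ()
  ... | busy _ p≡¬v _ _ _ = v≡c , trans p≡¬v (cong not v≡c)
    where
    v≡c : γ z i ≡ c
    v≡c = marked⇒≡ (trans (sym (visible sim i c)) (en (rpl (i , c)) (inj₁ (refl , refl))))

  plus-effect : ∀ {M M' z z' i c k} → Sim M z → Enabled N ((i , c , k) , plus) M →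
    Fires N ((i , c , k) , plus) M M' → Update z (vis i) (not c) z' → Sim M' z'
  plus-effect {M} {M'} {z} {z'} {i} {c} {k} sim en fires upd with node sim i
  ... | idle _ _ t-empty =
    contradiction (trans (sym (en (tpl (i , c , k)) (inj₁ refl))) (t-empty _ refl)) λ ()
  ... | busy _ _ c-empty _ unique = record { visible = visible' ; node = node' }
    where
    τ : Trans × Phase
    τ = ((i , c , k) , plus)
    ¬c≢c : not c ≢ c
    ¬c≢c = not-¬ refl ∘ sym

    r-places : ∀ w → M' (rpl (i , w)) ≡ marked (not c) w
    r-places w with w Bool.≟ c
    ... | yes refl = trans (fired-consumed N τ fires (rpl (i , c)) (refl , refl) (¬c≢c ∘ sym ∘ proj₂))
                           (sym (marked-≢ ¬c≢c))
    ... | no w≢c   = trans (fired-produced N τ fires (rpl (i , w)) (refl , ¬-not w≢c))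
                           (sym (marked-≡ (sym (¬-not w≢c))))

    c-places : ∀ w → M' (cpl (i , w)) ≡ marked (not c) w
    c-places w with w Bool.≟ c
    ... | yes refl = trans (fired-unchanged N τ fires (cpl (i , c)) (λ ()) (¬c≢c ∘ sym ∘ proj₂))
                           (trans (c-empty c) (sym (marked-≢ ¬c≢c)))
    ... | no w≢c   = trans (fired-produced N τ fires (cpl (i , w)) (refl , ¬-not w≢c))
                           (sym (marked-≡ (sym (¬-not w≢c))))

    -- p_t was the only marked t-place of node i, and it is consumed
    t-empty : ∀ t → proj₁ t ≡ i → M' (tpl t) ≡ false
    t-empty t t∈i with t ≟ₜ (i , c , k)
    ... | yes refl = fired-consumed N τ fires (tpl (i , c , k)) refl (λ ())
    ... | no t≢    = trans (fired-unchanged N τ fires (tpl t) t≢ (λ ()))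
      (¬-not λ t-marked → t≢ (trans (unique t t∈i t-marked)
                                    (sym (unique _ refl (en (tpl (i , c , k)) (inj₁ refl))))))

    visible' : ∀ i' w → M' (rpl (i' , w)) ≡ marked (γ z' i') w
    visible' i' w with i' Fin.≟ i
    ... | yes refl = trans (r-places w) (cong (λ b → marked b w) (sym (proj₁ upd)))
    ... | no i'≢i  = trans (fired-unchanged N τ fires (rpl (i' , w)) (i'≢i ∘ proj₁) (i'≢i ∘ proj₁))
      (trans (visible sim i' w) (cong (λ b → marked b w) (sym (vis-update-other upd i'≢i))))

    node' : ∀ i' → Node M' i' (pending z' i') (γ z' i')
    node' i' with i' Fin.≟ i
    ... | yes refl = node-cast (idle refl c-places t-empty)
      (trans (vis-update-pending upd i) (proj₂ (plus-busy sim en))) (proj₁ upd)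
    ... | no i'≢i = node-cast
      (node-transport (node sim i')
        (λ w → fired-unchanged N τ fires (cpl (i' , w)) (λ ()) (i'≢i ∘ proj₁))
        (λ t t∈i' → fired-unchanged N τ fires (tpl t)
                      (λ t≡ → i'≢i (trans (sym t∈i') (cong proj₁ t≡))) (λ ())))
      (vis-update-pending upd i') (vis-update-other upd i'≢i)

  forward : ∀ {M M' z} → Sim M z → NetStep N M M' →
    Σ[ z' ∈ State (n * 2) ] (AsyncStep (fIS f) z z' × Sim M' z')
  forward {z = z} sim (((i , c , k) , minus) , en , fires) =
    _ , update⇒step (fIS f) upd new-value (not-¬ p≡c) , minus-effect sim en fires upd
    where
    upd : Update z (pend i) (not c) (updateAt z (pend i) (const (not c)))
    upd = update-updateAt z (pend i) (not c)
    p≡c : pending z i ≡ c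
    p≡c = proj₁ (minus-idle sim en)
    new-value : not c ≡ fIS f z (pend i)
    new-value = sym (trans (fIS-idle f z i (trans p≡c (sym (proj₂ (minus-idle sim en)))))
                           (minus-guard sim en))
  forward {z = z} sim (((i , c , k) , plus) , en , fires) =
    _ , update⇒step (fIS f) upd (sym (trans (fIS-vis f z i) (proj₂ (plus-busy sim en))))
                        (not-¬ (proj₁ (plus-busy sim en)))
      , plus-effect sim en fires upd
    where
    upd : Update z (vis i) (not c) (updateAt z (vis i) (const (not c)))
    upd = update-updateAt z (vis i) (not c)

  -- a change of z_{2i-1} is matched by t^- of a clause enabled at γ z, a change of
  -- z_{2i} by t^+ of the transition that node i is busy with
  backward-at : ∀ {M z z' k} → Coordinate {n} k → Sim M z → z k ≢ fIS f z k →
    Update z k (fIS f z k) z' → Σ[ M' ∈ Mark ] (NetStep N M M' × Sim M' z')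
  backward-at {M} {z} {z'} (pendC i) sim changed upd with node sim i
  ... | busy _ p≡¬v _ _ _ = contradiction (sym (fIS-busy f z i p≡¬v)) changed
  ... | idle p≡v c-places _ =
    fire t M , (t , enabled , fire-fires t M) ,
    minus-effect sim enabled (fire-fires t M) (subst (λ w → Update z (pend i) w z') new-value upd)
    where
    f-flips : f (γ z) i ≡ not (γ z i)
    f-flips = ¬-not (λ e → changed (trans p≡v (sym (trans (fIS-idle f z i p≡v) e))))
    new-value : fIS f z (pend i) ≡ not (γ z i)
    new-value = trans (fIS-idle f z i p≡v) f-flips
    clause : Any (Sat (γ z)) (D i (γ z i))
    clause = Equivalence.from (proj₂ (isD i (γ z i)) (γ z)) (refl , f-flips)
    t : Trans × Phase
    t = ((i , γ z i , Any.index clause) , minus)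
    enabled : Enabled N t M
    enabled (cpl _) (inj₁ (refl , refl)) = trans (c-places _) (marked-self (γ z i))
    enabled (rpl (j , w)) (inj₂ (m , _)) =
      trans (visible sim j w) (marked-≡ (All.lookup (lookup-index clause) m))
    enabled (cpl _) (inj₂ ())
    enabled (rpl _) (inj₁ ())
    enabled (tpl _) (inj₁ ())
    enabled (tpl _) (inj₂ ())
  backward-at {M} {z} {z'} (visC i) sim changed upd with node sim i
  ... | idle p≡v _ _ = contradiction (sym (trans (fIS-vis f z i) p≡v)) changed
  ... | busy k p≡¬v _ t-marked _ =
    fire t M , (t , enabled , fire-fires t M) ,
    plus-effect sim enabled (fire-fires t M) (subst (λ w → Update z (vis i) w z') new-value upd)
    where
    new-value : fIS f z (vis i) ≡ not (γ z i)
    new-value = trans (fIS-vis f z i) p≡¬v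
    t : Trans × Phase
    t = ((i , γ z i , k) , plus)
    enabled : Enabled N t M
    enabled (rpl _) (inj₁ (refl , refl)) = trans (visible sim i _) (marked-self (γ z i))
    enabled (tpl _) (inj₁ refl) = t-marked
    enabled (cpl _) (inj₁ ())
    enabled (cpl _) (inj₂ ())
    enabled (rpl _) (inj₂ ())
    enabled (tpl _) (inj₂ ())

  backward : ∀ {M z z'} → Sim M z → AsyncStep (fIS f) z z' →
    Σ[ M' ∈ Mark ] (NetStep N M M' × Sim M' z')
  backward sim step with step⇒update (fIS f) step
  ... | k , changed , upd = backward-at (coordinate k) sim changed upd

  sim-init : ∀ x → Sim (liftMarking (encState x)) (α x)
  sim-init x = record
    { visible = λ i w → trans (encState-marked x i w) (cong (λ b → marked b w) (sym (α-vis x i)))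
    ; node    = λ i → node-cast (idle refl (encState-marked x i) (λ _ _ → refl)) (α-pend x i) (α-vis x i)
    }

  sim-final-state : ∀ {M z} y → Sim M z → (∀ q → M q ≡ liftMarking (encState y) q) →
    ∀ k → z k ≡ α y k
  sim-final-state {M} {z} y sim M≗ k = at (coordinate k)
    where
    v≡y : ∀ i → γ z i ≡ y i
    v≡y i = trans (sym (visible sim i true)) (M≗ (rpl (i , true)))
    at : ∀ {k} → Coordinate {n} k → z k ≡ α y k
    at (visC i) = trans (v≡y i) (sym (α-vis y i))
    at (pendC i) with node sim i
    ... | idle p≡v _ _ = trans p≡v (trans (v≡y i) (sym (α-pend y i)))
    ... | busy _ _ c-empty _ _ = contradiction
      (trans (sym (trans (M≗ (cpl (i , y i))) (trans (encState-marked y i (y i)) (marked-self (y i)))))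
             (c-empty (y i))) λ ()

  sim-final-marking : ∀ {M z} y → Sim M z → (∀ k → z k ≡ α y k) →
    ∀ q → M q ≡ liftMarking (encState y) q
  sim-final-marking {M} {z} y sim z≗ = at
    where
    v≡y : ∀ i → γ z i ≡ y i
    v≡y i = trans (z≗ (vis i)) (α-vis y i)
    -- every node is idle, since pending and visible values agree
    idle-at : ∀ i → (∀ w → M (cpl (i , w)) ≡ marked (γ z i) w) × (∀ t → proj₁ t ≡ i → M (tpl t) ≡ false)
    idle-at i with node sim i
    ... | idle _ c-places t-empty = c-places , t-empty
    ... | busy _ p≡¬v _ _ _ =
      contradiction p≡¬v (not-¬ (trans (z≗ (pend i)) (trans (α-pend y i) (sym (v≡y i)))))
    encodes-y : ∀ i w → marked (γ z i) w ≡ encState y (i , w)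
    encodes-y i w = trans (cong (λ b → marked b w) (v≡y i)) (sym (encState-marked y i w))
    at : ∀ q → M q ≡ liftMarking (encState y) q
    at (rpl (i , w)) = trans (visible sim i w) (encodes-y i w)
    at (cpl (i , w)) = trans (proj₁ (idle-at i) w) (encodes-y i w)
    at (tpl t)       = proj₂ (idle-at (proj₁ t)) t refl

theorem6 : (n : ℕ) (f : BN n) (D : DNFs n) → IsDNFs f D →
    (x y : State n) →
    Reach (NetStep (split (enc D))) (liftMarking (encState x)) (liftMarking (encState y))
      ⇔ Reach (AsyncStep (fIS f)) (α x) (α y)
theorem6 n f D isD x y = mk⇔ net⇒async async⇒net
  where
  open Simulation f D isD

  net⇒async : Reach (NetStep N) (liftMarking (encState x)) (liftMarking (encState y)) →
    Reach (AsyncStep (fIS f)) (α x) (α y)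
  net⇒async (M , run , M≗) with simulate Sim forward (sim-init x) run
  ... | z , run' , sim = z , run' , sim-final-state y sim M≗

  async⇒net : Reach (AsyncStep (fIS f)) (α x) (α y) →
    Reach (NetStep N) (liftMarking (encState x)) (liftMarking (encState y))
  async⇒net (z , run , z≗) with simulate (flip Sim) backward (sim-init x) run
  ... | M , run' , sim = M , run' , sim-final-marking y sim z≗
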